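{- Fix $d\geq1$, $X=\mathbb{N}^d$, $\mathbf{0}=(0,\dots,0)$, and $n,W\geq0$. The map sending a partition $[1]^{m_1}\cdots[d-1]^{m_{d-1}}$ (i.e. with $m_i$ parts equal to $i$) of $W$ having at most $n$ parts, each of size at most $d-1$, to $$g_1^{\,n-\sum_{i=1}^{d-1}m_i}\,g_2^{m_1}\cdots g_d^{m_{d-1}}(\mathbf{0})$$ is a bijection onto the set of $x\in X$ with $n(x)=n$ and $W(x)=W$.
   Context: For $x=(n_1,\dots,n_d)\in X$: $n(x)=\sum n_i$, $\Delta(x)=\{(1,n_1),\dots,(d,n_d)\}\subseteq[d]\times\mathbb{N}$ (conversely $d$ points with distinct first coordinates determine an element of $X$). For $\delta=(i,n)$, seat $i(\delta)=i$, height $h(\delta)=n+i/d$; points ordered by height; $\delta+s/d$ is the point of height $h(\delta)+s/d$. $\Delta(x)=\{\delta^1(x)\prec\cdots\prec\delta^d(x)\}$. $W(x)=\sum_{j<k}\lfloor h(\delta^k(x))-h(\delta^j(x))\rfloor$. Operator $g_j:X\to X$ ($j\in[d]$): $g_j(x)=x'$ with $\delta^k(x')=\delta^k(x)$ for $k<j$ and $\delta^k(x')=\delta^k(x)+s_k/d$ for $k\geq j$, $s_k$ the smallest positive integer with the seat of $\delta^k(x)+s_k/d$ in $\{i(\delta^j(x)),\dots,i(\delta^d(x))\}$. -}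

module Defs where

open import Data.Nat using (ℕ; zero; suc; _+_; _*_; _∸_; _≤_; _<ᵇ_; NonZero)
open import Data.Nat.Properties using (_<?_; _≤?_)
open import Data.Nat.DivMod using (_/_; _mod_)
open import Data.Fin using (Fin; toℕ; _≟_)
open import Data.Vec using (Vec; lookup; tabulate; replicate; toList)
import Data.Vec as Vec
open import Data.List using (List; []; _∷_; map; filter; length; concatMap; allFin)
open import Data.Nat.ListAction using (sum)
open import Data.Product using (_×_; _,_; proj₁; proj₂)
open import Data.Bool using (Bool; true; false; if_then_else_)
open import Relation.Nullary using (does)
open import Relation.Binary.PropositionalEquality using (_≡_)

-- Elements of X = ℕ^d are vectors  x = (n_1,…,n_d) : Vec ℕ d.
-- Seats [d] = {1,…,d} are represented by Fin d (seat i ↔ Fin index i-1).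
-- A point δ = (i , n) ∈ [d] × ℕ.
Point : ℕ → Set
Point d = Fin d × ℕ

module _ {d : ℕ} .{{_ : NonZero d}} where

  Δ : Vec ℕ d → List (Point d)
  Δ x = map (λ a → a , lookup x a) (allFin d)

  -- d · h(δ) = d·n + i   (heights scaled by d, so they are natural numbers)
  hgt : Point d → ℕ
  hgt (a , k) = k * d + suc (toℕ a)

  -- the point whose (scaled) height is H (for H ≥ 1): seat ((H-1) mod d)+1, level (H-1) div d
  pointOfHeight : ℕ → Point d
  pointOfHeight H = (H ∸ 1) mod d , (H ∸ 1) / d

  -- δ + s/d
  _+ₚ_ : Point d → ℕ → Point d
  δ +ₚ s = pointOfHeight (hgt δ + s)

  -- position k of δ in the height order δ^1(x) ≺ ⋯ ≺ δ^d(x) (1-based)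
  pos : Vec ℕ d → Point d → ℕ
  pos x δ = suc (length (filter (λ δ' → hgt δ' <? hgt δ) (Δ x)))

  Wt : Vec ℕ d → ℕ
  Wt x = sum (concatMap (λ δ → map (λ δ' →
           if pos x δ <ᵇ pos x δ' then (hgt δ' ∸ hgt δ) / d else 0) (Δ x)) (Δ x))

  nX : Vec ℕ d → ℕ
  nX x = Vec.sum x

  -- the element of X determined by d points with distinct seats
  seatLevel : Fin d → List (Point d) → ℕ
  seatLevel b [] = 0
  seatLevel b ((a , k) ∷ ps) = if does (a ≟ b) then k else seatLevel b ps

  fromPoints : List (Point d) → Vec ℕ d
  fromPoints ps = tabulate (λ b → seatLevel b ps)

  -- first s ∈ {start, start+1, …, start+fuel-1} with p s (start+fuel if none)
  firstFrom : (ℕ → Bool) → ℕ → ℕ → ℕ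
  firstFrom p zero s = s
  firstFrom p (suc f) s = if p s then s else firstFrom p f (suc s)

  -- membership of a seat b in {i(δ^j(x)),…,i(δ^d(x))}
  inTail : Vec ℕ d → ℕ → Fin d → Bool
  inTail x j b = does (j ≤? pos x (b , lookup x b))

  -- s_k: smallest positive integer s with seat of δ + s/d in the tail seat set.
  -- (Searching s = 1,…,d suffices since s = d returns to δ's own seat.)
  smallestShift : Vec ℕ d → ℕ → Point d → ℕ
  smallestShift x j δ = firstFrom (λ s → inTail x j (proj₁ (δ +ₚ s))) d 1

  -- the operator g_j  (j ∈ [d], 1-based, as in the paper)
  g : ℕ → Vec ℕ d → Vec ℕ d
  g j x = fromPoints (map (λ δ → if pos x δ <ᵇ j then δ else δ +ₚ smallestShift x j δ) (Δ x))

  iter : ℕ → (Vec ℕ d → Vec ℕ d) → Vec ℕ d → Vec ℕ d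
  iter zero f x = x
  iter (suc p) f x = f (iter p f x)

  applyGs : List (ℕ × ℕ) → Vec ℕ d → Vec ℕ d
  applyGs [] x = x
  applyGs ((j , p) ∷ rest) x = iter p (g j) (applyGs rest x)

  𝟎 : Vec ℕ d
  𝟎 = replicate d 0

  -- a partition [1]^{m_1}⋯[d-1]^{m_{d-1}} is given by its multiplicity vector
  -- m = (m_1,…,m_{d-1}) : Vec ℕ (d ∸ 1)   (Fin index k ↔ part size k+1)
  partWeight : Vec ℕ (d ∸ 1) → ℕ
  partWeight m = Vec.sum (tabulate (λ k → suc (toℕ k) * lookup m k))

  numParts : Vec ℕ (d ∸ 1) → ℕ
  numParts m = Vec.sum m

  -- m is a partition of W with at most n parts (each part ≤ d-1 by construction)
  IsPartition : ℕ → ℕ → Vec ℕ (d ∸ 1) → Set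
  IsPartition n W m = (partWeight m ≡ W) × (numParts m ≤ n)

  Φ : ℕ → Vec ℕ (d ∸ 1) → Vec ℕ d
  Φ n m = applyGs ((1 , n ∸ numParts m) ∷ toList (tabulate (λ k → suc (suc (toℕ k)) , lookup m k))) 𝟎

-- Scale heights by d, so that the point (i, k) has height k·d + i; then W(x) is the sum of
-- ⌊(h′ − h)/d⌋ over all ordered pairs of heights of x (truncated subtraction). The operator g₁
-- adds 1 to every scaled height, so it is the rotation x ↦ (x_d + 1, x_1, …, x_{d−1}): it raises
-- n(x) by one and, seeing only height differences, preserves W. When x_1 = 0 the point (1, 0) is
-- the lowest one, so for j ≥ 2 it never moves under g_j, while the other points move exactly as
-- under g_{j−1} in dimension d − 1; and W(0, z) = n(z) + W(z). Hence in dimension d + 1,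
-- Φ(n, (m₁, m)) is the (n − m₁ − Σm)-th rotation of (0, Φ(m₁ + Σm, m)). Since every vector is a
-- rotation power of a unique (0, z), induction on d gives image, injectivity and surjectivity.

module Submission where

open import Defs
open import Data.Nat using (ℕ; zero; suc; _+_; _*_; _∸_; _≤_; _<_; _<ᵇ_; z≤n; s≤s; s<s; s<s⁻¹; NonZero; >-nonZero⁻¹)
open import Data.Nat.Properties hiding (_≟_)
open import Data.Nat.DivMod using (_%_; _/_; _mod_; [m+kn]%n≡m%n; [m+n]%n≡m%n; m<n⇒m%n≡m; m*n%n≡0; +-distrib-/;
  m*n/n≡m; m<n⇒m/n≡0; m≡m%n+[m/n]*n; 0/n≡0)
open import Data.Nat.ListAction using (sum)
open import Data.Nat.ListAction.Properties using (sum-++; sum-↭)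
open import Data.Nat.Solver using (module +-*-Solver)
open import Algebra.Properties.CommutativeSemigroup +-commutativeSemigroup using (interchange)
open import Data.Fin using (Fin; toℕ; fromℕ; inject₁; _≟_)
import Data.Fin as Fin
open import Data.Fin.Properties using (toℕ-fromℕ<; toℕ-injective; toℕ<n; toℕ-fromℕ; toℕ-inject₁)
open import Data.Product using (_×_; _,_; proj₁; proj₂; Σ; ∃; ∃₂; map₂)
open import Data.Product.Relation.Binary.Lex.Strict using (×-Lex)
open import Data.Sum using (_⊎_; inj₁; inj₂)
open import Data.Bool using (Bool; true; false; if_then_else_; T)
open import Data.Empty using (⊥-elim)
open import Data.List using (List; []; _∷_; map; filter; length; concatMap; allFin; tabulate; _++_; [_])
open import Data.List.Properties using (map-cong; map-cong-local; map-∘; map-++; map-tabulate; tabulate-cong;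
  filter-accept; filter-none)
open import Data.List.Relation.Unary.All as All using (All; []; _∷_)
open import Data.List.Relation.Unary.All.Properties using (map⁺; tabulate⁺)
open import Data.List.Relation.Unary.Any as Any using (Any; here; there)
open import Data.List.Relation.Unary.Any.Properties using () renaming (map⁺ to Any-map⁺)
open import Data.List.Membership.Propositional using (_∈_)
open import Data.List.Membership.Propositional.Properties using (∈-allFin)
open import Data.List.Relation.Binary.Permutation.Propositional using (_↭_)
import Data.List.Relation.Binary.Permutation.Propositional.Properties as ↭
open import Data.Vec using (Vec; lookup; []; _∷_; _∷ʳ_; init; last; initLast; toList)
import Data.Vec as Vec
import Data.Vec.Properties as Vecₚ
open import Function using (_∘_)
open import Level using (0ℓ)
open import Relation.Binary using (Rel; tri<; tri≈; tri>)
open import Relation.Binary.PropositionalEquality hiding ([_])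
open import Relation.Nullary using (¬_; yes; no; does; Dec)
open import Relation.Unary using (Pred; Decidable; _⊆_)

open +-*-Solver using (solve; _:+_; _:*_; _:=_; con)

_<ₗₑₓ_ : Rel (ℕ × ℕ) 0ℓ
_<ₗₑₓ_ = ×-Lex _≡_ _<_ _<_

module _ (n : ℕ) .{{_ : NonZero n}} where

  [k*n+r]%n≡r : ∀ k {r} → r < n → (k * n + r) % n ≡ r
  [k*n+r]%n≡r k {r} r<n = begin
    (k * n + r) % n ≡⟨ cong (_% n) (+-comm (k * n) r) ⟩
    (r + k * n) % n ≡⟨ [m+kn]%n≡m%n r k n ⟩
    r % n           ≡⟨ m<n⇒m%n≡m r<n ⟩
    r               ∎
    where open ≡-Reasoning

  [k*n+r]/n≡k : ∀ k {r} → r < n → (k * n + r) / n ≡ k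
  [k*n+r]/n≡k k {r} r<n = begin
    (k * n + r) / n   ≡⟨ +-distrib-/ (k * n) r (subst (_< n) (sym digitsSum) r<n) ⟩
    k * n / n + r / n ≡⟨ cong₂ _+_ (m*n/n≡m k n) (m<n⇒m/n≡0 r<n) ⟩
    k + 0             ≡⟨ +-identityʳ k ⟩
    k                 ∎
    where
    open ≡-Reasoning
    digitsSum : (k * n) % n + r % n ≡ r
    digitsSum = cong₂ _+_ (m*n%n≡0 k n) (m<n⇒m%n≡m r<n)

lex⇒*+-< : ∀ n {k k′ r r′} → r < n → (k , r) <ₗₑₓ (k′ , r′) → k * n + r < k′ * n + r′
lex⇒*+-< n {k} {k′} {r} {r′} r<n (inj₁ k<k′) = begin-strict
  k * n + r  <⟨ +-monoʳ-< (k * n) r<n ⟩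
  k * n + n  ≡⟨ +-comm (k * n) n ⟩
  suc k * n  ≤⟨ *-monoˡ-≤ n k<k′ ⟩
  k′ * n     ≤⟨ m≤m+n (k′ * n) r′ ⟩
  k′ * n + r′ ∎
  where open ≤-Reasoning
lex⇒*+-< n {k} r<n (inj₂ (refl , r<r′)) = +-monoʳ-< (k * n) r<r′

*+-<⇒lex : ∀ n {k k′ r r′} → r < n → r′ < n → k * n + r < k′ * n + r′ → (k , r) <ₗₑₓ (k′ , r′)
*+-<⇒lex n {k} {k′} {r} {r′} r<n r′<n lt with <-cmp k k′
... | tri< k<k′ _ _ = inj₁ k<k′
... | tri≈ _ refl _ = inj₂ (refl , +-cancelˡ-< (k * n) r r′ lt)
... | tri> _ _ k′<k = ⊥-elim (<-asym lt (lex⇒*+-< n r′<n (inj₁ k′<k)))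

lex-suc : ∀ {k k′ r r′} → (k , r) <ₗₑₓ (k′ , r′) → (k , suc r) <ₗₑₓ (k′ , suc r′)
lex-suc (inj₁ k<k′)          = inj₁ k<k′
lex-suc (inj₂ (k≡k′ , r<r′)) = inj₂ (k≡k′ , s<s r<r′)

lex-suc⁻¹ : ∀ {k k′ r r′} → (k , suc r) <ₗₑₓ (k′ , suc r′) → (k , r) <ₗₑₓ (k′ , r′)
lex-suc⁻¹ (inj₁ k<k′)          = inj₁ k<k′
lex-suc⁻¹ (inj₂ (k≡k′ , r<r′)) = inj₂ (k≡k′ , s<s⁻¹ r<r′)

borrow : ℕ → ℕ → ℕ
borrow r r′ = if r <ᵇ r′ then 1 else 0

[t*n+[n+r]∸r′]/n : ∀ n .{{_ : NonZero n}} t {r r′} → r < n → r′ < n →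
  (t * n + (n + r) ∸ r′) / n ≡ suc t ∸ borrow r r′
[t*n+[n+r]∸r′]/n n t {r} {r′} r<n r′<n = by-cases (r <ᵇ r′) refl
  where
  open ≡-Reasoning
  by-cases : ∀ b → (r <ᵇ r′) ≡ b → (t * n + (n + r) ∸ r′) / n ≡ suc t ∸ (if b then 1 else 0)
  by-cases true r<ᵇr′ = begin
    (t * n + (n + r) ∸ r′) / n   ≡⟨ cong (_/ n) (+-∸-assoc (t * n) (≤-trans (<⇒≤ r′<n) (m≤m+n n r))) ⟩
    (t * n + (n + r ∸ r′)) / n   ≡⟨ [k*n+r]/n≡k n t (m<n+o⇒m∸n<o (n + r) r′ n+r<r′+n) ⟩
    t                            ∎
    where
    n+r<r′+n : n + r < r′ + n
    n+r<r′+n = subst (n + r <_) (+-comm n r′) (+-monoʳ-< n (<ᵇ⇒< r r′ (subst T (sym r<ᵇr′) _)))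
  by-cases false r≮ᵇr′ = begin
    (t * n + (n + r) ∸ r′) / n   ≡⟨ cong (_/ n) (+-∸-assoc (t * n) (≤-trans r′≤r (m≤n+m r n))) ⟩
    (t * n + (n + r ∸ r′)) / n   ≡⟨ cong (λ m → (t * n + m) / n) (+-∸-assoc n r′≤r) ⟩
    (t * n + (n + (r ∸ r′))) / n ≡⟨ cong (_/ n) (+-assoc (t * n) n (r ∸ r′)) ⟨
    (t * n + n + (r ∸ r′)) / n   ≡⟨ cong (λ m → (m + (r ∸ r′)) / n) (+-comm (t * n) n) ⟩
    (suc t * n + (r ∸ r′)) / n   ≡⟨ [k*n+r]/n≡k n (suc t) (≤-<-trans (m∸n≤m r r′) r<n) ⟩
    suc t                        ∎
    where
    r′≤r : r′ ≤ r
    r′≤r = ≮⇒≥ (λ r<r′ → subst T r≮ᵇr′ (<⇒<ᵇ r<r′))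

[k*n+r]∸[k′*n+r′]/n : ∀ n .{{_ : NonZero n}} k k′ {r r′} → r < n → r′ < n →
  (k * n + r ∸ (k′ * n + r′)) / n ≡ k ∸ k′ ∸ borrow r r′
[k*n+r]∸[k′*n+r′]/n n k k′ {r} {r′} r<n r′<n with <-cmp k k′
... | tri< k<k′ _ _ = begin
  (k * n + r ∸ (k′ * n + r′)) / n ≡⟨ cong (_/ n) (m≤n⇒m∸n≡0 (<⇒≤ (lex⇒*+-< n r<n (inj₁ k<k′)))) ⟩
  0 / n                           ≡⟨ 0/n≡0 n ⟩
  0                               ≡⟨ 0∸n≡0 (borrow r r′) ⟨
  0 ∸ borrow r r′                 ≡⟨ cong (_∸ borrow r r′) (m≤n⇒m∸n≡0 (<⇒≤ k<k′)) ⟨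
  k ∸ k′ ∸ borrow r r′            ∎
  where open ≡-Reasoning
... | tri≈ _ refl _ = begin
  (k * n + r ∸ (k * n + r′)) / n  ≡⟨ cong (_/ n) ([m+n]∸[m+o]≡n∸o (k * n) r r′) ⟩
  (r ∸ r′) / n                    ≡⟨ m<n⇒m/n≡0 (≤-<-trans (m∸n≤m r r′) r<n) ⟩
  0                               ≡⟨ 0∸n≡0 (borrow r r′) ⟨
  0 ∸ borrow r r′                 ≡⟨ cong (_∸ borrow r r′) (n∸n≡0 k) ⟨
  k ∸ k ∸ borrow r r′             ∎
  where open ≡-Reasoning
... | tri> _ _ k′<k with m≤n⇒∃[o]m+o≡n k′<k
... | t , refl = begin
  ((suc k′ + t) * n + r ∸ (k′ * n + r′)) / n       ≡⟨ cong (λ m → (m ∸ (k′ * n + r′)) / n) regroup ⟩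
  (k′ * n + (t * n + (n + r)) ∸ (k′ * n + r′)) / n ≡⟨ cong (_/ n) ([m+n]∸[m+o]≡n∸o (k′ * n) _ r′) ⟩
  (t * n + (n + r) ∸ r′) / n                       ≡⟨ [t*n+[n+r]∸r′]/n n t r<n r′<n ⟩
  suc t ∸ borrow r r′                              ≡⟨ cong (_∸ borrow r r′) (m+n∸m≡n k′ (suc t)) ⟨
  k′ + suc t ∸ k′ ∸ borrow r r′                    ≡⟨ cong (λ m → m ∸ k′ ∸ borrow r r′) (+-suc k′ t) ⟩
  suc k′ + t ∸ k′ ∸ borrow r r′                    ∎
  where
  open ≡-Reasoning
  regroup : (suc k′ + t) * n + r ≡ k′ * n + (t * n + (n + r))
  regroup = solve 4 (λ k′ t n r → (con 1 :+ k′ :+ t) :* n :+ r := k′ :* n :+ (t :* n :+ (n :+ r))) refl k′ t n r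

module _ {d : ℕ} .{{_ : NonZero d}} where

  firstFrom-spec : ∀ (p : ℕ → Bool) f s {t} → s ≤ t → t < s + f → T (p t) →
    s ≤ firstFrom p f s × T (p (firstFrom p f s)) × (∀ u → s ≤ u → u < firstFrom p f s → ¬ T (p u))
  firstFrom-spec p zero s s≤t t<s+0 pt = ⊥-elim (<⇒≱ (subst (_ <_) (+-identityʳ s) t<s+0) s≤t)
  firstFrom-spec p (suc f) s {t} s≤t t<s+1+f pt with p s in ps
  ... | true = ≤-refl , subst T (sym ps) _ , λ u s≤u u<s → ⊥-elim (<⇒≱ u<s s≤u)
  ... | false with m≤n⇒m<n∨m≡n s≤t
  ...   | inj₂ refl = ⊥-elim (subst T ps pt)
  ...   | inj₁ s<t with firstFrom-spec p f (suc s) s<t (subst (t <_) (+-suc s f) t<s+1+f) pt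
  ...     | s<r , pr , below = <⇒≤ s<r , pr , miss
    where
    miss : ∀ u → s ≤ u → u < firstFrom p f (suc s) → ¬ T (p u)
    miss u s≤u u<r with m≤n⇒m<n∨m≡n s≤u
    ... | inj₁ s<u = below u s<u u<r
    ... | inj₂ refl = subst T ps

  hgt≡suc : ∀ (δ : Point d) → hgt δ ≡ suc (proj₂ δ * d + toℕ (proj₁ δ))
  hgt≡suc (a , k) = +-suc (k * d) (toℕ a)

  hgt-positive : ∀ (δ : Point d) → 0 < hgt δ
  hgt-positive δ = subst (0 <_) (sym (hgt≡suc δ)) (s≤s z≤n)

  hgt-pointOfHeight : ∀ H → hgt (pointOfHeight (suc H)) ≡ suc H
  hgt-pointOfHeight H = begin
    H / d * d + suc (toℕ (H mod d)) ≡⟨ cong (λ r → H / d * d + suc r) (toℕ-fromℕ< _) ⟩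
    H / d * d + suc (H % d)         ≡⟨ +-suc (H / d * d) (H % d) ⟩
    suc (H / d * d + H % d)         ≡⟨ cong suc (+-comm (H / d * d) (H % d)) ⟩
    suc (H % d + H / d * d)         ≡⟨ cong suc (sym (m≡m%n+[m/n]*n H d)) ⟩
    suc H                           ∎
    where open ≡-Reasoning

  pointOfHeight-hgt : ∀ (δ : Point d) → pointOfHeight (hgt δ) ≡ δ
  pointOfHeight-hgt δ@(a , k) = cong₂ _,_
    (toℕ-injective (trans (toℕ-fromℕ< _) (trans (cong (_% d) H∸1) ([k*n+r]%n≡r d k (toℕ<n a)))))
    (trans (cong (_/ d) H∸1) ([k*n+r]/n≡k d k (toℕ<n a)))
    where
    H∸1 : hgt δ ∸ 1 ≡ k * d + toℕ a
    H∸1 = cong (_∸ 1) (hgt≡suc δ)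

  hgt-injective : ∀ {δ δ′ : Point d} → hgt δ ≡ hgt δ′ → δ ≡ δ′
  hgt-injective {δ} {δ′} eq = begin
    δ                     ≡⟨ sym (pointOfHeight-hgt δ) ⟩
    pointOfHeight (hgt δ)  ≡⟨ cong pointOfHeight eq ⟩
    pointOfHeight (hgt δ′) ≡⟨ pointOfHeight-hgt δ′ ⟩
    δ′                    ∎
    where open ≡-Reasoning

  hgt-+ₚ : ∀ (δ : Point d) s → hgt (δ +ₚ s) ≡ hgt δ + s
  hgt-+ₚ δ s = begin
    hgt (pointOfHeight (hgt δ + s))                  ≡⟨ cong (λ H → hgt (pointOfHeight (H + s))) (hgt≡suc δ) ⟩
    hgt (pointOfHeight (suc (proj₂ δ * d + toℕ (proj₁ δ) + s))) ≡⟨ hgt-pointOfHeight _ ⟩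
    suc (proj₂ δ * d + toℕ (proj₁ δ) + s)            ≡⟨ cong (_+ s) (sym (hgt≡suc δ)) ⟩
    hgt δ + s                                        ∎
    where open ≡-Reasoning

  +ₚ-gap : ∀ {δ ρ : Point d} → hgt δ ≤ hgt ρ → δ +ₚ (hgt ρ ∸ hgt δ) ≡ ρ
  +ₚ-gap {δ} {ρ} δ≤ρ = trans (cong pointOfHeight (m+[n∸m]≡n δ≤ρ)) (pointOfHeight-hgt ρ)

  seat-+ₚ-d : ∀ (δ : Point d) → proj₁ (δ +ₚ d) ≡ proj₁ δ
  seat-+ₚ-d δ = begin
    proj₁ (pointOfHeight (hgt δ + d))                    ≡⟨ cong (λ H → proj₁ (pointOfHeight (H + d))) (hgt≡suc δ) ⟩
    (proj₂ δ * d + toℕ (proj₁ δ) + d) mod d              ≡⟨ toℕ-injective (trans (toℕ-fromℕ< _)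
                                                              (trans ([m+n]%n≡m%n _ d) (sym (toℕ-fromℕ< _)))) ⟩
    (proj₂ δ * d + toℕ (proj₁ δ)) mod d                  ≡⟨ cong proj₁ (trans (cong pointOfHeight (sym (hgt≡suc δ)))
                                                              (pointOfHeight-hgt δ)) ⟩
    proj₁ δ                                              ∎
    where open ≡-Reasoning

  key : Point d → ℕ × ℕ
  key (a , k) = k , toℕ a

  hgt-<⇒key-< : ∀ {δ δ′ : Point d} → hgt δ < hgt δ′ → key δ <ₗₑₓ key δ′
  hgt-<⇒key-< {δ@(a , _)} {δ′@(a′ , _)} lt =
    *+-<⇒lex d (toℕ<n a) (toℕ<n a′) (s<s⁻¹ (subst₂ _<_ (hgt≡suc δ) (hgt≡suc δ′) lt))

  key-<⇒hgt-< : ∀ {δ δ′ : Point d} → key δ <ₗₑₓ key δ′ → hgt δ < hgt δ′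
  key-<⇒hgt-< {δ@(a , _)} {δ′} lt =
    subst₂ _<_ (sym (hgt≡suc δ)) (sym (hgt≡suc δ′)) (s<s (lex⇒*+-< d (toℕ<n a) lt))

  record IsNextIn (τ : Fin d → Bool) (δ ρ : Point d) : Set where
    field
      above  : hgt δ < hgt ρ
      member : T (τ (proj₁ ρ))
      first  : ∀ ρ′ → hgt δ < hgt ρ′ → hgt ρ′ < hgt ρ → ¬ T (τ (proj₁ ρ′))

  nextIn : (Fin d → Bool) → Point d → Point d
  nextIn τ δ = δ +ₚ firstFrom (λ s → τ (proj₁ (δ +ₚ s))) d 1

  nextIn-isNextIn : ∀ τ δ → T (τ (proj₁ δ)) → IsNextIn τ δ (nextIn τ δ)
  nextIn-isNextIn τ δ τδ = record
    { above  = subst (hgt δ <_) (sym (hgt-+ₚ δ s)) (m<m+n (hgt δ) (proj₁ spec))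
    ; member = proj₁ (proj₂ spec)
    ; first  = λ ρ′ δ<ρ′ ρ′<ρ → subst (λ ρ → ¬ T (τ (proj₁ ρ))) (+ₚ-gap {δ} {ρ′} (<⇒≤ δ<ρ′))
                 (proj₂ (proj₂ spec) (hgt ρ′ ∸ hgt δ) (m<n⇒0<n∸m δ<ρ′) (gap<s (<⇒≤ δ<ρ′) ρ′<ρ))
    }
    where
    p : ℕ → Bool
    p s = τ (proj₁ (δ +ₚ s))
    s : ℕ
    s = firstFrom p d 1
    spec : 1 ≤ s × T (p s) × (∀ u → 1 ≤ u → u < s → ¬ T (p u))
    spec = firstFrom-spec p d 1 (>-nonZero⁻¹ d) ≤-refl (subst (λ a → T (τ a)) (sym (seat-+ₚ-d δ)) τδ)
    gap<s : ∀ {H} → hgt δ ≤ H → H < hgt (δ +ₚ s) → H ∸ hgt δ < s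
    gap<s {H} δ≤H H<ρ = subst (H ∸ hgt δ <_) (m+n∸m≡n (hgt δ) s)
                          (∸-monoˡ-< (subst (H <_) (hgt-+ₚ δ s) H<ρ) δ≤H)

  isNextIn-unique : ∀ {τ δ ρ ρ′} → IsNextIn τ δ ρ → IsNextIn τ δ ρ′ → ρ ≡ ρ′
  isNextIn-unique {ρ = ρ} {ρ′} next next′ with <-cmp (hgt ρ) (hgt ρ′)
  ... | tri< ρ<ρ′ _ _ = ⊥-elim (IsNextIn.first next′ ρ (IsNextIn.above next) ρ<ρ′ (IsNextIn.member next))
  ... | tri≈ _ ρ≡ρ′ _ = hgt-injective ρ≡ρ′
  ... | tri> _ _ ρ′<ρ = ⊥-elim (IsNextIn.first next ρ′ (IsNextIn.above next′) ρ′<ρ (IsNextIn.member next′))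

sum-concatMap : ∀ {a} {A : Set a} (f : A → List ℕ) xs → sum (concatMap f xs) ≡ sum (map (sum ∘ f) xs)
sum-concatMap f []       = refl
sum-concatMap f (x ∷ xs) = trans (sum-++ (f x) (concatMap f xs)) (cong (sum (f x) +_) (sum-concatMap f xs))

module _ {a p q} {A : Set a} {P : Pred A p} {Q : Pred A q} (P? : Decidable P) (Q? : Decidable Q) where

  length-filter-mono : P ⊆ Q → ∀ xs → length (filter P? xs) ≤ length (filter Q? xs)
  length-filter-mono P⊆Q []       = z≤n
  length-filter-mono P⊆Q (x ∷ xs) with P? x | Q? x
  ... | yes _  | yes _  = s≤s (length-filter-mono P⊆Q xs)
  ... | no _   | yes _  = m≤n⇒m≤1+n (length-filter-mono P⊆Q xs)
  ... | no _   | no _   = length-filter-mono P⊆Q xs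
  ... | yes px | no ¬qx = ⊥-elim (¬qx (P⊆Q px))

  length-filter-mono-< : P ⊆ Q → ∀ {y xs} → y ∈ xs → Q y → ¬ P y →
                          length (filter P? xs) < length (filter Q? xs)
  length-filter-mono-< P⊆Q {xs = x ∷ xs} (here refl) qy ¬py with P? x | Q? x
  ... | yes py | _      = ⊥-elim (¬py py)
  ... | no _   | no ¬qy = ⊥-elim (¬qy qy)
  ... | no _   | yes _  = s≤s (length-filter-mono P⊆Q xs)
  length-filter-mono-< P⊆Q {xs = x ∷ xs} (there y∈xs) qy ¬py with P? x | Q? x
  ... | yes _  | yes _  = s≤s (length-filter-mono-< P⊆Q y∈xs qy ¬py)
  ... | no _   | yes _  = m<n⇒m<1+n (length-filter-mono-< P⊆Q y∈xs qy ¬py)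
  ... | no _   | no _   = length-filter-mono-< P⊆Q y∈xs qy ¬py
  ... | yes px | no ¬qx = ⊥-elim (¬qx (P⊆Q px))

length-filter-map : ∀ {a b p q} {A : Set a} {B : Set b} {P : Pred A p} {Q : Pred B q}
  (P? : Decidable P) (Q? : Decidable Q) (f : B → A) → (∀ y → Q y → P (f y)) → (∀ y → P (f y) → Q y) →
  ∀ ys → length (filter P? (map f ys)) ≡ length (filter Q? ys)
length-filter-map P? Q? f Q⇒P P⇒Q []       = refl
length-filter-map P? Q? f Q⇒P P⇒Q (y ∷ ys) with P? (f y) | Q? y
... | yes _   | yes _  = cong suc (length-filter-map P? Q? f Q⇒P P⇒Q ys)
... | no _    | no _   = length-filter-map P? Q? f Q⇒P P⇒Q ys
... | yes pfy | no ¬qy = ⊥-elim (¬qy (P⇒Q y pfy))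
... | no ¬pfy | yes qy = ⊥-elim (¬pfy (Q⇒P y qy))

module _ {d : ℕ} .{{_ : NonZero d}} where

  heights : Vec ℕ d → List ℕ
  heights x = map hgt (Δ x)

  gapSum : List ℕ → ℕ
  gapSum hs = sum (map (λ h → sum (map (λ h′ → (h′ ∸ h) / d) hs)) hs)

  pos-mono : ∀ x {δ δ′ : Point d} → δ ∈ Δ x → hgt δ < hgt δ′ → pos x δ < pos x δ′
  pos-mono x {δ} {δ′} δ∈Δx δ<δ′ = s≤s (length-filter-mono-< (λ ε → hgt ε <? hgt δ) (λ ε → hgt ε <? hgt δ′)
                            (λ ε<δ → <-trans ε<δ δ<δ′) δ∈Δx δ<δ′ (<-irrefl refl))

  -- In W the condition on positions is redundant: a pair out of height order contributes ⌊0/d⌋ = 0.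
  Wt≡gapSum : ∀ x → Wt x ≡ gapSum (heights x)
  Wt≡gapSum x = begin
    Wt x                                          ≡⟨ sum-concatMap _ (Δ x) ⟩
    sum (map (λ δ → sum (map (term δ) (Δ x))) (Δ x)) ≡⟨ cong sum (map-cong-local (All.tabulate λ δ∈ →
                                                        cong sum (map-cong (drop-pos δ∈) (Δ x)))) ⟩
    sum (map (λ δ → sum (map (λ δ′ → (hgt δ′ ∸ hgt δ) / d) (Δ x))) (Δ x))
                                                  ≡⟨ cong sum (map-cong (λ δ → cong sum (map-∘ (Δ x))) (Δ x)) ⟩
    sum (map (λ δ → sum (map (λ h′ → (h′ ∸ hgt δ) / d) (heights x))) (Δ x))
                                                  ≡⟨ cong sum (map-∘ (Δ x)) ⟩
    gapSum (heights x)                            ∎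
    where
    open ≡-Reasoning
    term : Point d → Point d → ℕ
    term δ δ′ = if pos x δ <ᵇ pos x δ′ then (hgt δ′ ∸ hgt δ) / d else 0
    vanishing : ∀ b {m} → m ≡ 0 → (if b then m / d else 0) ≡ m / d
    vanishing true  _    = refl
    vanishing false refl = sym (0/n≡0 d)
    drop-pos : ∀ {δ} → δ ∈ Δ x → ∀ δ′ → term δ δ′ ≡ (hgt δ′ ∸ hgt δ) / d
    drop-pos {δ} δ∈ δ′ with hgt δ <? hgt δ′
    ... | no δ≮δ′ = vanishing (pos x δ <ᵇ pos x δ′) (m≤n⇒m∸n≡0 (≮⇒≥ δ≮δ′))
    ... | yes δ<δ′ with pos x δ <ᵇ pos x δ′ | <⇒<ᵇ (pos-mono x {δ} {δ′} δ∈ δ<δ′)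
    ...   | true  | _  = refl
    ...   | false | ()

  gapSum-↭ : ∀ {hs hs′} → hs ↭ hs′ → gapSum hs ≡ gapSum hs′
  gapSum-↭ {hs} {hs′} p = trans
    (cong sum (map-cong (λ h → sum-↭ (↭.map⁺ (λ h′ → (h′ ∸ h) / d) p)) hs))
    (sum-↭ (↭.map⁺ (λ h → sum (map (λ h′ → (h′ ∸ h) / d) hs′)) p))

  gapSum-map-suc : ∀ hs → gapSum (map suc hs) ≡ gapSum hs
  gapSum-map-suc hs = trans (cong sum (sym (map-∘ hs))) (cong sum (map-cong (λ h → cong sum (sym (map-∘ hs))) hs))

levelSeats : ∀ {n} → ℕ → Vec ℕ n → List (ℕ × ℕ)
levelSeats o []      = []
levelSeats o (k ∷ v) = (k , o) ∷ levelSeats (suc o) v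

levelSeats-tabulate : ∀ {n} (v : Vec ℕ n) o → tabulate (λ a → lookup v a , o + toℕ a) ≡ levelSeats o v
levelSeats-tabulate []      o = refl
levelSeats-tabulate (k ∷ v) o = cong₂ _∷_ (cong (k ,_) (+-identityʳ o))
  (trans (tabulate-cong (λ a → cong (lookup v a ,_) (+-suc o (toℕ a)))) (levelSeats-tabulate v (suc o)))

levelSeats-suc : ∀ {n} (v : Vec ℕ n) o → levelSeats (suc o) v ≡ map (map₂ suc) (levelSeats o v)
levelSeats-suc []      o = refl
levelSeats-suc (k ∷ v) o = cong ((k , suc o) ∷_) (levelSeats-suc v (suc o))

levelSeats-∷ʳ : ∀ {n} (v : Vec ℕ n) k o → levelSeats o (v ∷ʳ k) ≡ levelSeats o v ++ [ k , o + n ]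
levelSeats-∷ʳ []      k o = cong (λ r → [ k , r ]) (sym (+-identityʳ o))
levelSeats-∷ʳ {suc n} (k′ ∷ v) k o = cong ((k′ , o) ∷_)
  (trans (levelSeats-∷ʳ v k (suc o)) (cong (λ r → levelSeats (suc o) v ++ [ k , r ]) (sym (+-suc o n))))

levelSeats-bounded : ∀ {n} (v : Vec ℕ n) o → All (λ p → proj₂ p < o + n) (levelSeats o v)
levelSeats-bounded []      o = []
levelSeats-bounded {suc n} (k ∷ v) o = subst (o <_) (sym (+-suc o n)) (s≤s (m≤m+n o n))
  ∷ All.map (λ {p} → subst (proj₂ p <_) (sym (+-suc o n))) (levelSeats-bounded v (suc o))

sum-levelSeats : ∀ {n} (v : Vec ℕ n) o → sum (map proj₁ (levelSeats o v)) ≡ Vec.sum v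
sum-levelSeats []      o = refl
sum-levelSeats (k ∷ v) o = cong (k +_) (sum-levelSeats v (suc o))

numeral : ℕ → ℕ × ℕ → ℕ
numeral n (k , r) = k * n + suc r

keyGapSum : List (ℕ × ℕ) → ℕ
keyGapSum ps = sum (map (λ p → sum (map (λ q → proj₁ q ∸ proj₁ p ∸ borrow (proj₂ q) (proj₂ p)) ps)) ps)

numeral-gap : ∀ n .{{_ : NonZero n}} {p q : ℕ × ℕ} → proj₂ p < n → proj₂ q < n →
  (numeral n q ∸ numeral n p) / n ≡ proj₁ q ∸ proj₁ p ∸ borrow (proj₂ q) (proj₂ p)
numeral-gap n {k , r} {k′ , r′} r<n r′<n =
  trans (cong (_/ n) (cong₂ _∸_ (+-suc (k′ * n) r′) (+-suc (k * n) r))) ([k*n+r]∸[k′*n+r′]/n n k′ k r′<n r<n)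

module _ {d : ℕ} .{{_ : NonZero d}} where

  map-key-Δ : ∀ x → map key (Δ x) ≡ levelSeats 0 x
  map-key-Δ x = begin
    map key (map (λ a → a , lookup x a) (allFin d)) ≡⟨ map-∘ (allFin d) ⟨
    map (λ a → lookup x a , toℕ a) (allFin d)       ≡⟨ map-tabulate (λ a → a) _ ⟩
    tabulate (λ a → lookup x a , toℕ a)             ≡⟨ levelSeats-tabulate x 0 ⟩
    levelSeats 0 x                                  ∎
    where open ≡-Reasoning

  heights≡numerals : ∀ x → heights x ≡ map (numeral d) (levelSeats 0 x)
  heights≡numerals x = trans (map-∘ (Δ x)) (cong (map (numeral d)) (map-key-Δ x))

  gapSum-numerals : ∀ {ps} → All (λ p → proj₂ p < d) ps → gapSum (map (numeral d) ps) ≡ keyGapSum ps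
  gapSum-numerals {ps} bounded = begin
    gapSum (map (numeral d) ps)
      ≡⟨ cong sum (map-∘ ps) ⟨
    sum (map (λ p → sum (map (λ h′ → (h′ ∸ numeral d p) / d) (map (numeral d) ps))) ps)
      ≡⟨ cong sum (map-cong (λ p → cong sum (map-∘ ps)) ps) ⟨
    sum (map (λ p → sum (map (λ q → (numeral d q ∸ numeral d p) / d) ps)) ps)
      ≡⟨ cong sum (map-cong-local (All.map (λ {p} p<d → cong sum
         (map-cong-local (All.map (λ {q} → numeral-gap d {p} {q} p<d) bounded))) bounded)) ⟩
    keyGapSum ps ∎
    where open ≡-Reasoning

  Wt≡keyGapSum : ∀ x → Wt x ≡ keyGapSum (levelSeats 0 x)
  Wt≡keyGapSum x = begin
    Wt x                                     ≡⟨ Wt≡gapSum x ⟩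
    gapSum (heights x)                       ≡⟨ cong gapSum (heights≡numerals x) ⟩
    gapSum (map (numeral d) (levelSeats 0 x)) ≡⟨ gapSum-numerals (levelSeats-bounded x 0) ⟩
    keyGapSum (levelSeats 0 x)               ∎
    where open ≡-Reasoning

keyGapSum-origin∷ : ∀ ps → keyGapSum ((0 , 0) ∷ map (map₂ suc) ps) ≡ sum (map proj₁ ps) + keyGapSum ps
keyGapSum-origin∷ ps = cong₂ _+_ (cong sum (sym (map-∘ ps))) (begin
  sum (map row (map (map₂ suc) ps)) ≡⟨ cong sum (map-∘ ps) ⟨
  sum (map (row ∘ map₂ suc) ps)     ≡⟨ cong sum (map-cong (λ p → cong₂ _+_ (cong (_∸ 1) (0∸n≡0 (proj₁ p)))
                                                                       (cong sum (sym (map-∘ ps)))) ps) ⟩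
  keyGapSum ps                      ∎)
  where
  open ≡-Reasoning
  qs : List (ℕ × ℕ)
  qs = (0 , 0) ∷ map (map₂ suc) ps
  row : ℕ × ℕ → ℕ
  row p = sum (map (λ q → proj₁ q ∸ proj₁ p ∸ borrow (proj₂ q) (proj₂ p)) qs)

module _ {e : ℕ} where

  Wt-0∷ : ∀ (z : Vec ℕ (suc e)) → Wt (0 ∷ z) ≡ Vec.sum z + Wt z
  Wt-0∷ z = begin
    Wt (0 ∷ z)                                      ≡⟨ Wt≡keyGapSum (0 ∷ z) ⟩
    keyGapSum ((0 , 0) ∷ levelSeats 1 z)            ≡⟨ cong (keyGapSum ∘ ((0 , 0) ∷_)) (levelSeats-suc z 0) ⟩
    keyGapSum ((0 , 0) ∷ map (map₂ suc) (levelSeats 0 z)) ≡⟨ keyGapSum-origin∷ (levelSeats 0 z) ⟩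
    sum (map proj₁ (levelSeats 0 z)) + keyGapSum (levelSeats 0 z) ≡⟨ cong₂ _+_ (sum-levelSeats z 0) (sym (Wt≡keyGapSum z)) ⟩
    Vec.sum z + Wt z                                ∎
    where open ≡-Reasoning

module _ {d : ℕ} .{{_ : NonZero d}} where

  seatLevel-exact : ∀ {y : Vec ℕ d} {b} {δs} → All (λ δ → proj₂ δ ≡ lookup y (proj₁ δ)) δs →
    Any (λ δ → proj₁ δ ≡ b) δs → seatLevel b δs ≡ lookup y b
  seatLevel-exact {y} {b} {(a , k) ∷ δs} (k≡ya ∷ exact) hit with a ≟ b
  ... | yes refl = k≡ya
  ... | no a≢b with hit
  ...   | here a≡b = ⊥-elim (a≢b a≡b)
  ...   | there hit′ = seatLevel-exact {y} exact hit′

  fromPoints-exact : ∀ {y : Vec ℕ d} {δs} → All (λ δ → proj₂ δ ≡ lookup y (proj₁ δ)) δs →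
    (∀ b → Any (λ δ → proj₁ δ ≡ b) δs) → fromPoints δs ≡ y
  fromPoints-exact {y} exact hits =
    trans (Vecₚ.tabulate-cong (λ b → seatLevel-exact {y} exact (hits b))) (Vecₚ.tabulate∘lookup y)

rotate : ∀ {n} → Vec ℕ (suc n) → Vec ℕ (suc n)
rotate x = suc (last x) ∷ init x

rotate-∷ʳ : ∀ {n} (xs : Vec ℕ n) a → rotate (xs ∷ʳ a) ≡ suc a ∷ xs
rotate-∷ʳ xs a = cong₂ (λ k ys → suc k ∷ ys) (Vecₚ.last-∷ʳ a xs) (Vecₚ.init-∷ʳ a xs)

init-∷ʳ-last : ∀ {n} (x : Vec ℕ (suc n)) → init x ∷ʳ last x ≡ x
init-∷ʳ-last x = sym (proj₂ (proj₂ (initLast x)))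

rotate-injective : ∀ {n} {x y : Vec ℕ (suc n)} → rotate x ≡ rotate y → x ≡ y
rotate-injective {x = x} {y} eq = begin
  x                   ≡⟨ init-∷ʳ-last x ⟨
  init x ∷ʳ last x    ≡⟨ cong₂ _∷ʳ_ (Vecₚ.∷-injectiveʳ eq) (suc-injective (Vecₚ.∷-injectiveˡ eq)) ⟩
  init y ∷ʳ last y    ≡⟨ init-∷ʳ-last y ⟩
  y                   ∎
  where open ≡-Reasoning

sum-∷ʳ : ∀ {n} (xs : Vec ℕ n) a → Vec.sum (xs ∷ʳ a) ≡ Vec.sum xs + a
sum-∷ʳ []       a = +-identityʳ a
sum-∷ʳ (k ∷ xs) a = trans (cong (k +_) (sum-∷ʳ xs a)) (sym (+-assoc k (Vec.sum xs) a))

sum-rotate : ∀ {n} (x : Vec ℕ (suc n)) → Vec.sum (rotate x) ≡ suc (Vec.sum x)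
sum-rotate x = begin
  suc (last x + Vec.sum (init x))  ≡⟨ cong suc (+-comm (last x) _) ⟩
  suc (Vec.sum (init x) + last x)  ≡⟨ cong suc (sum-∷ʳ (init x) (last x)) ⟨
  suc (Vec.sum (init x ∷ʳ last x)) ≡⟨ cong (suc ∘ Vec.sum) (init-∷ʳ-last x) ⟩
  suc (Vec.sum x)                  ∎
  where open ≡-Reasoning

module _ {n : ℕ} where

  numeral-wrap : ∀ k → numeral (suc n) (suc k , 0) ≡ suc (numeral (suc n) (k , n))
  numeral-wrap k = solve 2 (λ k n → (con 1 :+ k) :* (con 1 :+ n) :+ con 1 := con 1 :+ (k :* (con 1 :+ n) :+ (con 1 :+ n))) refl k n

  numeral-suc-seat : ∀ (p : ℕ × ℕ) → numeral (suc n) (map₂ suc p) ≡ suc (numeral (suc n) p)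
  numeral-suc-seat (k , r) = +-suc (k * suc n) (suc r)

  heights-rotate-∷ʳ : ∀ (xs : Vec ℕ n) a → heights (suc a ∷ xs) ↭ map suc (heights (xs ∷ʳ a))
  heights-rotate-∷ʳ xs a = subst₂ _↭_ (sym (heights≡numerals (suc a ∷ xs))) (sym shifted) (↭.∷↭∷ʳ _ _)
    where
    open ≡-Reasoning
    shifted : map suc (heights (xs ∷ʳ a)) ≡ map (numeral (suc n)) (levelSeats 1 xs) ++ [ numeral (suc n) (suc a , 0) ]
    shifted = begin
      map suc (heights (xs ∷ʳ a))
        ≡⟨ cong (map suc) (trans (heights≡numerals (xs ∷ʳ a)) (cong (map (numeral (suc n))) (levelSeats-∷ʳ xs a 0))) ⟩
      map suc (map (numeral (suc n)) (levelSeats 0 xs ++ [ a , n ]))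
        ≡⟨ map-∘ (levelSeats 0 xs ++ [ a , n ]) ⟨
      map (suc ∘ numeral (suc n)) (levelSeats 0 xs ++ [ a , n ])
        ≡⟨ map-++ _ (levelSeats 0 xs) [ a , n ] ⟩
      map (suc ∘ numeral (suc n)) (levelSeats 0 xs) ++ [ suc (numeral (suc n) (a , n)) ]
        ≡⟨ cong₂ _++_ (map-cong (λ p → sym (numeral-suc-seat p)) (levelSeats 0 xs)) (cong [_] (sym (numeral-wrap a))) ⟩
      map (numeral (suc n) ∘ map₂ suc) (levelSeats 0 xs) ++ [ numeral (suc n) (suc a , 0) ]
        ≡⟨ cong (_++ _) (trans (map-∘ (levelSeats 0 xs)) (cong (map (numeral (suc n))) (sym (levelSeats-suc xs 0)))) ⟩
      map (numeral (suc n)) (levelSeats 1 xs) ++ [ numeral (suc n) (suc a , 0) ] ∎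

  Wt-rotate : ∀ (x : Vec ℕ (suc n)) → Wt (rotate x) ≡ Wt x
  Wt-rotate x = begin
    Wt (rotate x)                      ≡⟨ cong (Wt ∘ rotate) (init-∷ʳ-last x) ⟨
    Wt (rotate (xs ∷ʳ a))              ≡⟨ cong Wt (rotate-∷ʳ xs a) ⟩
    Wt (suc a ∷ xs)                    ≡⟨ Wt≡gapSum (suc a ∷ xs) ⟩
    gapSum (heights (suc a ∷ xs))      ≡⟨ gapSum-↭ (heights-rotate-∷ʳ xs a) ⟩
    gapSum (map suc (heights (xs ∷ʳ a))) ≡⟨ gapSum-map-suc (heights (xs ∷ʳ a)) ⟩
    gapSum (heights (xs ∷ʳ a))         ≡⟨ Wt≡gapSum (xs ∷ʳ a) ⟨
    Wt (xs ∷ʳ a)                       ≡⟨ cong Wt (init-∷ʳ-last x) ⟩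
    Wt x                               ∎
    where
    open ≡-Reasoning
    xs : Vec ℕ n
    xs = init x
    a : ℕ
    a = last x

fromℕ⊎inject₁ : ∀ {n} (c : Fin (suc n)) → c ≡ fromℕ n ⊎ ∃ λ i → c ≡ inject₁ i
fromℕ⊎inject₁ {zero}  Fin.zero    = inj₁ refl
fromℕ⊎inject₁ {suc n} Fin.zero    = inj₂ (Fin.zero , refl)
fromℕ⊎inject₁ {suc n} (Fin.suc c) with fromℕ⊎inject₁ c
... | inj₁ c≡n       = inj₁ (cong Fin.suc c≡n)
... | inj₂ (i , c≡i) = inj₂ (Fin.suc i , cong Fin.suc c≡i)

lookup-∷ʳ-fromℕ : ∀ {n} (xs : Vec ℕ n) a → lookup (xs ∷ʳ a) (fromℕ n) ≡ a
lookup-∷ʳ-fromℕ []       a = refl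
lookup-∷ʳ-fromℕ (k ∷ xs) a = lookup-∷ʳ-fromℕ xs a

lookup-∷ʳ-inject₁ : ∀ {n} (xs : Vec ℕ n) a i → lookup (xs ∷ʳ a) (inject₁ i) ≡ lookup xs i
lookup-∷ʳ-inject₁ (k ∷ xs) a Fin.zero    = refl
lookup-∷ʳ-inject₁ (k ∷ xs) a (Fin.suc i) = lookup-∷ʳ-inject₁ xs a i

module _ {n : ℕ} where

  +ₚ1-inject₁ : ∀ (i : Fin n) k → _+ₚ_ {suc n} (inject₁ i , k) 1 ≡ (Fin.suc i , k)
  +ₚ1-inject₁ i k = hgt-injective (begin
    hgt ((inject₁ i , k) +ₚ 1)             ≡⟨ hgt-+ₚ (inject₁ i , k) 1 ⟩
    k * suc n + suc (toℕ (inject₁ i)) + 1   ≡⟨ cong (λ r → k * suc n + suc r + 1) (toℕ-inject₁ i) ⟩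
    k * suc n + suc (toℕ i) + 1            ≡⟨ +-comm _ 1 ⟩
    suc (k * suc n + suc (toℕ i))          ≡⟨ +-suc (k * suc n) (suc (toℕ i)) ⟨
    k * suc n + suc (suc (toℕ i))          ∎)
    where open ≡-Reasoning

  +ₚ1-fromℕ : ∀ k → _+ₚ_ {suc n} (fromℕ n , k) 1 ≡ (Fin.zero , suc k)
  +ₚ1-fromℕ k = hgt-injective (begin
    hgt ((fromℕ n , k) +ₚ 1)               ≡⟨ hgt-+ₚ (fromℕ n , k) 1 ⟩
    k * suc n + suc (toℕ (fromℕ n)) + 1     ≡⟨ cong (λ r → k * suc n + suc r + 1) (toℕ-fromℕ n) ⟩
    k * suc n + suc n + 1                  ≡⟨ cong (_+ 1) (+-comm (k * suc n) (suc n)) ⟩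
    suc k * suc n + 1                      ∎)
    where open ≡-Reasoning

  g₁-∷ʳ : ∀ (xs : Vec ℕ n) a → g 1 (xs ∷ʳ a) ≡ suc a ∷ xs
  g₁-∷ʳ xs a = fromPoints-exact {δs = map (_+ₚ 1) (Δ x)}
    (map⁺ (map⁺ (tabulate⁺ exact)))
    (λ b → Any-map⁺ (Any-map⁺ (hit b)))
    where
    x : Vec ℕ (suc n)
    x = xs ∷ʳ a
    point : Fin (suc n) → Point (suc n)
    point c = (c , lookup x c) +ₚ 1
    Fits : Point (suc n) → Set
    Fits ρ = proj₂ ρ ≡ lookup (suc a ∷ xs) (proj₁ ρ)
    exact : ∀ c → Fits (point c)
    exact c with fromℕ⊎inject₁ c
    ... | inj₁ refl       = subst Fits (sym (+ₚ1-fromℕ _)) (cong suc (lookup-∷ʳ-fromℕ xs a))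
    ... | inj₂ (i , refl) = subst Fits (sym (+ₚ1-inject₁ i _)) (lookup-∷ʳ-inject₁ xs a i)
    hit : ∀ b → Any (λ c → proj₁ (point c) ≡ b) (allFin (suc n))
    hit Fin.zero    = Any.map (λ { refl → cong proj₁ (+ₚ1-fromℕ (lookup x (fromℕ n))) }) (∈-allFin (fromℕ n))
    hit (Fin.suc i) = Any.map (λ { refl → cong proj₁ (+ₚ1-inject₁ i (lookup x (inject₁ i))) }) (∈-allFin (inject₁ i))

  g₁≡rotate : ∀ (x : Vec ℕ (suc n)) → g 1 x ≡ rotate x
  g₁≡rotate x = begin
    g 1 x                  ≡⟨ cong (g 1) (init-∷ʳ-last x) ⟨
    g 1 (init x ∷ʳ last x)  ≡⟨ g₁-∷ʳ (init x) (last x) ⟩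
    suc (last x) ∷ init x  ∎
    where open ≡-Reasoning

module _ {e : ℕ} where

  lift : Point (suc e) → Point (suc (suc e))
  lift (c , k) = Fin.suc c , k

  origin : Point (suc (suc e))
  origin = Fin.zero , 0

  lift-< : ∀ δ δ′ → hgt δ < hgt δ′ → hgt (lift δ) < hgt (lift δ′)
  lift-< δ δ′ = key-<⇒hgt-< {δ = lift δ} {lift δ′} ∘ lex-suc ∘ hgt-<⇒key-< {δ = δ} {δ′}

  lift-<⁻¹ : ∀ δ δ′ → hgt (lift δ) < hgt (lift δ′) → hgt δ < hgt δ′
  lift-<⁻¹ δ δ′ = key-<⇒hgt-< {δ = δ} {δ′} ∘ lex-suc⁻¹ ∘ hgt-<⇒key-< {δ = lift δ} {lift δ′}

  origin-lowest : ∀ δ → hgt origin < hgt (lift δ)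
  origin-lowest (c , k) = ≤-trans (s≤s (s≤s z≤n)) (m≤n+m (suc (suc (toℕ c))) (k * suc (suc e)))

  Δ-0∷ : ∀ (z : Vec ℕ (suc e)) → Δ (0 ∷ z) ≡ origin ∷ map lift (Δ z)
  Δ-0∷ z = cong (origin ∷_)
    (trans (map-tabulate Fin.suc _) (sym (trans (sym (map-∘ (allFin (suc e)))) (map-tabulate (λ c → c) _))))

  module _ (z : Vec ℕ (suc e)) where

    pos-lift : ∀ δ → pos (0 ∷ z) (lift δ) ≡ suc (pos z δ)
    pos-lift δ = cong suc (begin
      length (filter (below (lift δ)) (Δ (0 ∷ z)))
        ≡⟨ cong (length ∘ filter (below (lift δ))) (Δ-0∷ z) ⟩
      length (filter (below (lift δ)) (origin ∷ map lift (Δ z)))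
        ≡⟨ cong length (filter-accept (below (lift δ)) (origin-lowest δ)) ⟩
      suc (length (filter (below (lift δ)) (map lift (Δ z))))
        ≡⟨ cong suc (length-filter-map (below (lift δ)) (below δ) lift (λ ε → lift-< ε δ) (λ ε → lift-<⁻¹ ε δ) (Δ z)) ⟩
      suc (length (filter (below δ) (Δ z))) ∎)
      where
      open ≡-Reasoning
      below : ∀ {d} .{{_ : NonZero d}} (δ ε : Point d) → Dec (hgt ε < hgt δ)
      below δ ε = hgt ε <? hgt δ

    pos-origin : pos (0 ∷ z) origin ≡ 1
    pos-origin = cong (suc ∘ length) (filter-none (λ ε → hgt ε <? 1)
                   (All.universal (λ δ δ<1 → <⇒≱ δ<1 (hgt-positive δ)) (Δ (0 ∷ z))))

  isNextIn-lift : ∀ {τx : Fin (suc (suc e)) → Bool} {τz : Fin (suc e) → Bool} →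
    (∀ c → τx (Fin.suc c) ≡ τz c) → ¬ T (τx Fin.zero) →
    ∀ {δ ρ} → IsNextIn τz δ ρ → IsNextIn τx (lift δ) (lift ρ)
  isNextIn-lift {τx} {τz} τx∘suc ¬τx0 {δ} {ρ} next = record
    { above  = lift-< δ ρ (IsNextIn.above next)
    ; member = subst T (sym (τx∘suc (proj₁ ρ))) (IsNextIn.member next)
    ; first  = skipped
    }
    where
    skipped : ∀ ρ′ → hgt (lift δ) < hgt ρ′ → hgt ρ′ < hgt (lift ρ) → ¬ T (τx (proj₁ ρ′))
    skipped (Fin.zero  , k) _ _        = ¬τx0
    skipped (Fin.suc c , k) δ<ρ′ ρ′<ρ =
      IsNextIn.first next (c , k) (lift-<⁻¹ δ (c , k) δ<ρ′) (lift-<⁻¹ (c , k) ρ ρ′<ρ) ∘ subst T (τx∘suc c)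

  fromPoints-lift : ∀ δs → fromPoints (origin ∷ map lift δs) ≡ 0 ∷ fromPoints δs
  fromPoints-lift δs = cong (0 ∷_) (Vecₚ.tabulate-cong (λ c → seatLevel-lift c δs))
    where
    seatLevel-lift : ∀ c δs → seatLevel (Fin.suc c) (map lift δs) ≡ seatLevel c δs
    seatLevel-lift c []             = refl
    seatLevel-lift c ((a , k) ∷ δs) = cong (if does (a ≟ c) then k else_) (seatLevel-lift c δs)

step : ∀ {d} .{{_ : NonZero d}} → Vec ℕ d → ℕ → Point d → Point d
step y j δ = if pos y δ <ᵇ j then δ else nextIn (inTail y j) δ

module _ {e : ℕ} (z : Vec ℕ (suc e)) (j : ℕ) where

  private
    x : Vec ℕ (suc (suc e))
    x = 0 ∷ z
    τx : Fin (suc (suc e)) → Bool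
    τx = inTail x (suc (suc j))
    τz : Fin (suc e) → Bool
    τz = inTail z (suc j)

    τx∘suc : ∀ c → τx (Fin.suc c) ≡ τz c
    τx∘suc c = cong (λ p → does (suc (suc j) ≤? p)) (pos-lift z (c , lookup z c))

    ¬τx0 : ¬ T (τx Fin.zero)
    ¬τx0 = subst (λ p → ¬ T (does (suc (suc j) ≤? p))) (sym (pos-origin z)) λ ()

    nextIn-lift : ∀ δ → T (τz (proj₁ δ)) → nextIn τx (lift δ) ≡ lift (nextIn τz δ)
    nextIn-lift δ τδ = isNextIn-unique
      (nextIn-isNextIn τx (lift δ) (subst T (sym (τx∘suc (proj₁ δ))) τδ))
      (isNextIn-lift τx∘suc ¬τx0 (nextIn-isNextIn τz δ τδ))

    step-lift : ∀ b → step x (suc (suc j)) (lift (b , lookup z b)) ≡ lift (step z (suc j) (b , lookup z b))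
    step-lift b = trans (cong (λ p → if p <ᵇ suc (suc j) then lift δ else nextIn τx (lift δ)) (pos-lift z δ))
                        (by-cases (pos z δ <ᵇ suc j) refl)
      where
      δ : Point (suc e)
      δ = b , lookup z b
      by-cases : ∀ c → (pos z δ <ᵇ suc j) ≡ c →
        (if c then lift δ else nextIn τx (lift δ)) ≡ lift (if c then δ else nextIn τz δ)
      by-cases true  _    = refl
      by-cases false p≮J = nextIn-lift δ (≤⇒≤ᵇ (≮⇒≥ (λ p<J → subst T p≮J (<⇒<ᵇ {pos z δ} {suc j} p<J))))

  g-0∷ : g (suc (suc j)) (0 ∷ z) ≡ 0 ∷ g (suc j) z
  g-0∷ = begin
    fromPoints (map (step x (suc (suc j))) (Δ x))
      ≡⟨ cong (fromPoints ∘ map (step x (suc (suc j)))) (Δ-0∷ z) ⟩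
    fromPoints (step x (suc (suc j)) origin ∷ map (step x (suc (suc j))) (map lift (Δ z)))
      ≡⟨ cong₂ (λ ρ ρs → fromPoints (ρ ∷ ρs)) origin-stays lifted ⟩
    fromPoints (origin ∷ map lift (map (step z (suc j)) (Δ z)))
      ≡⟨ fromPoints-lift (map (step z (suc j)) (Δ z)) ⟩
    0 ∷ g (suc j) z ∎
    where
    open ≡-Reasoning
    origin-stays : step x (suc (suc j)) origin ≡ origin
    origin-stays = cong (λ p → if p <ᵇ suc (suc j) then origin else nextIn τx origin) (pos-origin z)
    lifted : map (step x (suc (suc j))) (map lift (Δ z)) ≡ map lift (map (step z (suc j)) (Δ z))
    lifted = begin
      map (step x (suc (suc j))) (map lift (Δ z))  ≡⟨ trans (map-∘ (allFin (suc e))) (map-∘ (Δ z)) ⟨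
      map (step x (suc (suc j)) ∘ lift ∘ (λ b → b , lookup z b)) (allFin (suc e))
                                                   ≡⟨ map-cong step-lift (allFin (suc e)) ⟩
      map (lift ∘ step z (suc j) ∘ (λ b → b , lookup z b)) (allFin (suc e))
                                                   ≡⟨ trans (map-∘ (allFin (suc e))) (map-∘ (Δ z)) ⟩
      map lift (map (step z (suc j)) (Δ z))        ∎

module _ {e : ℕ} where

  iter-g₁ : ∀ k (x : Vec ℕ (suc e)) → iter k (g 1) x ≡ iter k rotate x
  iter-g₁ zero    x = refl
  iter-g₁ (suc k) x = trans (g₁≡rotate (iter k (g 1) x)) (cong rotate (iter-g₁ k x))

  iter-g-0∷ : ∀ k j (z : Vec ℕ (suc e)) → iter k (g (suc (suc j))) (0 ∷ z) ≡ 0 ∷ iter k (g (suc j)) z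
  iter-g-0∷ zero    j z = refl
  iter-g-0∷ (suc k) j z = trans (cong (g (suc (suc j))) (iter-g-0∷ k j z)) (g-0∷ (iter k (g (suc j)) z) j)

  applyGs-0∷ : ∀ {n} (f : Fin n → ℕ) (v : Vec ℕ n) (z : Vec ℕ (suc e)) →
    applyGs (toList (Vec.tabulate (λ k → suc (suc (f k)) , lookup v k))) (0 ∷ z)
      ≡ 0 ∷ applyGs (toList (Vec.tabulate (λ k → suc (f k) , lookup v k))) z
  applyGs-0∷ f []      z = refl
  applyGs-0∷ f (p ∷ v) z = trans (cong (iter p (g (suc (suc (f Fin.zero))))) (applyGs-0∷ (f ∘ Fin.suc) v z))
                                 (iter-g-0∷ p (f Fin.zero) _)

  iter-rotate-sum : ∀ s (x : Vec ℕ (suc e)) → nX (iter s rotate x) ≡ s + nX x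
  iter-rotate-sum zero    x = refl
  iter-rotate-sum (suc s) x = trans (sum-rotate (iter s rotate x)) (cong suc (iter-rotate-sum s x))

  iter-rotate-Wt : ∀ s (x : Vec ℕ (suc e)) → Wt (iter s rotate x) ≡ Wt x
  iter-rotate-Wt zero    x = refl
  iter-rotate-Wt (suc s) x = trans (Wt-rotate (iter s rotate x)) (iter-rotate-Wt s x)

  rotate-normalForm : ∀ (x : Vec ℕ (suc e)) → ∃₂ λ s z → iter s rotate (0 ∷ z) ≡ x
  rotate-normalForm x = go (nX x) x ≤-refl
    where
    go : ∀ N (x : Vec ℕ (suc e)) → nX x ≤ N → ∃₂ λ s z → iter s rotate (0 ∷ z) ≡ x
    go N       (zero  ∷ z) _ = 0 , z , refl
    go zero    (suc h ∷ t) ()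
    go (suc N) (suc h ∷ t) (s≤s h+t≤N)
      with go N (t ∷ʳ h) (subst (_≤ N) (trans (+-comm h (Vec.sum t)) (sym (sum-∷ʳ t h))) h+t≤N)
    ... | s , z , eq = suc s , z , trans (cong rotate eq) (rotate-∷ʳ t h)

  rotate-normalForm-unique : ∀ s s′ (z z′ : Vec ℕ e) →
    iter s rotate (0 ∷ z) ≡ iter s′ rotate (0 ∷ z′) → s ≡ s′ × z ≡ z′
  rotate-normalForm-unique zero     zero     z z′ eq = refl , Vecₚ.∷-injectiveʳ eq
  rotate-normalForm-unique (suc s)  (suc s′) z z′ eq with rotate-normalForm-unique s s′ z z′ (rotate-injective eq)
  ... | s≡s′ , z≡z′ = cong suc s≡s′ , z≡z′
  rotate-normalForm-unique zero     (suc s′) z z′ eq with () ← Vecₚ.∷-injectiveˡ eq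
  rotate-normalForm-unique (suc s)  zero     z z′ eq with () ← Vecₚ.∷-injectiveˡ eq

Φ₁ : ∀ n → Φ {d = 1} n [] ≡ n ∷ []
Φ₁ n = trans (iter-g₁ n (0 ∷ [])) (rotations n)
  where
  rotations : ∀ n → iter n rotate (0 ∷ []) ≡ n ∷ []
  rotations zero    = refl
  rotations (suc n) = cong rotate (rotations n)

Φ-step : ∀ {e} n m₁ (m : Vec ℕ e) →
  Φ {d = suc (suc e)} n (m₁ ∷ m) ≡ iter (n ∸ (m₁ + Vec.sum m)) rotate (0 ∷ Φ {d = suc e} (m₁ + Vec.sum m) m)
Φ-step {e} n m₁ m = begin
  Φ n (m₁ ∷ m)                                                    ≡⟨⟩
  iter (n ∸ S) (g 1) (iter m₁ (g 2) (applyGs (word 2) (0 ∷ 𝟎)))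
    ≡⟨ iter-g₁ (n ∸ S) _ ⟩
  iter (n ∸ S) rotate (iter m₁ (g 2) (applyGs (word 2) (0 ∷ 𝟎)))
    ≡⟨ cong (iter (n ∸ S) rotate ∘ iter m₁ (g 2)) (applyGs-0∷ (λ k → suc (toℕ k)) m 𝟎) ⟩
  iter (n ∸ S) rotate (iter m₁ (g 2) (0 ∷ applyGs (word 1) 𝟎))
    ≡⟨ cong (iter (n ∸ S) rotate) (iter-g-0∷ m₁ 0 _) ⟩
  iter (n ∸ S) rotate (0 ∷ iter m₁ (g 1) (applyGs (word 1) 𝟎))
    ≡⟨ cong (λ k → iter (n ∸ S) rotate (0 ∷ iter k (g 1) (applyGs (word 1) 𝟎))) (m+n∸n≡m m₁ (Vec.sum m)) ⟨
  iter (n ∸ S) rotate (0 ∷ Φ S m) ∎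
  where
  open ≡-Reasoning
  S : ℕ
  S = m₁ + Vec.sum m
  word : ℕ → List (ℕ × ℕ)
  word o = toList (Vec.tabulate (λ k → suc (o + toℕ k) , lookup m k))

sum-tabulate-+ : ∀ {n} (f h : Fin n → ℕ) →
  Vec.sum (Vec.tabulate (λ k → f k + h k)) ≡ Vec.sum (Vec.tabulate f) + Vec.sum (Vec.tabulate h)
sum-tabulate-+ {zero}  f h = refl
sum-tabulate-+ {suc n} f h = trans (cong (f Fin.zero + h Fin.zero +_) (sum-tabulate-+ (f ∘ Fin.suc) (h ∘ Fin.suc)))
                                   (interchange (f Fin.zero) (h Fin.zero) _ _)

partWeight-step : ∀ {e} m₁ (m : Vec ℕ e) →
  partWeight {d = suc (suc e)} (m₁ ∷ m) ≡ (m₁ + Vec.sum m) + partWeight {d = suc e} m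
partWeight-step m₁ m = begin
  1 * m₁ + Vec.sum (Vec.tabulate (λ k → lookup m k + suc (toℕ k) * lookup m k))
    ≡⟨ cong₂ _+_ (*-identityˡ m₁) (sum-tabulate-+ (lookup m) _) ⟩
  m₁ + (Vec.sum (Vec.tabulate (lookup m)) + partWeight m)
    ≡⟨ cong (λ v → m₁ + (Vec.sum v + partWeight m)) (Vecₚ.tabulate∘lookup m) ⟩
  m₁ + (Vec.sum m + partWeight m)
    ≡⟨ +-assoc m₁ (Vec.sum m) _ ⟨
  m₁ + Vec.sum m + partWeight m ∎
  where open ≡-Reasoning

nX-Φ : ∀ {e} n (m : Vec ℕ e) → numParts {d = suc e} m ≤ n → nX (Φ n m) ≡ n
nX-Φ n []       _    = trans (cong nX (Φ₁ n)) (+-identityʳ n)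
nX-Φ n (m₁ ∷ m) S≤n = begin
  nX (Φ n (m₁ ∷ m))                    ≡⟨ cong nX (Φ-step n m₁ m) ⟩
  nX (iter (n ∸ S) rotate (0 ∷ Φ S m)) ≡⟨ iter-rotate-sum (n ∸ S) _ ⟩
  n ∸ S + nX (Φ S m)                   ≡⟨ cong (n ∸ S +_) (nX-Φ S m (m≤n+m (Vec.sum m) m₁)) ⟩
  n ∸ S + S                            ≡⟨ m∸n+n≡m S≤n ⟩
  n                                    ∎
  where
  open ≡-Reasoning
  S : ℕ
  S = m₁ + Vec.sum m

Wt-Φ : ∀ {e} n (m : Vec ℕ e) → numParts {d = suc e} m ≤ n → Wt (Φ n m) ≡ partWeight {d = suc e} m
Wt-Φ n []       _   = trans (cong Wt (Φ₁ n)) (trans (Wt≡keyGapSum (n ∷ [])) (cong (λ k → k + 0 + 0) (n∸n≡0 n)))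
Wt-Φ n (m₁ ∷ m) S≤n = begin
  Wt (Φ n (m₁ ∷ m))                    ≡⟨ cong Wt (Φ-step n m₁ m) ⟩
  Wt (iter (n ∸ S) rotate (0 ∷ Φ S m)) ≡⟨ iter-rotate-Wt (n ∸ S) _ ⟩
  Wt (0 ∷ Φ S m)                       ≡⟨ Wt-0∷ (Φ S m) ⟩
  nX (Φ S m) + Wt (Φ S m)              ≡⟨ cong₂ _+_ (nX-Φ S m S′≤S) (Wt-Φ S m S′≤S) ⟩
  S + partWeight m                     ≡⟨ partWeight-step m₁ m ⟨
  partWeight (m₁ ∷ m)                  ∎
  where
  open ≡-Reasoning
  S : ℕ
  S = m₁ + Vec.sum m
  S′≤S : Vec.sum m ≤ S
  S′≤S = m≤n+m (Vec.sum m) m₁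

Φ-injective : ∀ {e} n (m m′ : Vec ℕ e) → numParts {d = suc e} m ≤ n → numParts {d = suc e} m′ ≤ n →
  Φ n m ≡ Φ n m′ → m ≡ m′
Φ-injective n []       []         _ _ _  = refl
Φ-injective n (m₁ ∷ m) (m₁′ ∷ m′) _ _ eq = cong₂ _∷_ m₁≡m₁′ m≡m′
  where
  S S′ : ℕ
  S  = m₁ + Vec.sum m
  S′ = m₁′ + Vec.sum m′
  inner≡ : Φ S m ≡ Φ S′ m′
  inner≡ = proj₂ (rotate-normalForm-unique (n ∸ S) (n ∸ S′) _ _
    (trans (sym (Φ-step n m₁ m)) (trans eq (Φ-step n m₁′ m′))))
  S≡S′ : S ≡ S′
  S≡S′ = trans (sym (nX-Φ S m (m≤n+m _ m₁))) (trans (cong nX inner≡) (nX-Φ S′ m′ (m≤n+m _ m₁′)))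
  m≡m′ : m ≡ m′
  m≡m′ = Φ-injective S m m′ (m≤n+m _ m₁) (subst (Vec.sum m′ ≤_) (sym S≡S′) (m≤n+m _ m₁′))
           (trans inner≡ (cong (λ k → Φ k m′) (sym S≡S′)))
  m₁≡m₁′ : m₁ ≡ m₁′
  m₁≡m₁′ = +-cancelʳ-≡ (Vec.sum m) m₁ m₁′ (trans S≡S′ (cong (λ v → m₁′ + Vec.sum v) (sym m≡m′)))

Φ-surjective : ∀ {e} n (x : Vec ℕ (suc e)) → nX x ≡ n → Σ (Vec ℕ e) λ m → numParts {d = suc e} m ≤ n × Φ n m ≡ x
Φ-surjective {zero}  _ (a ∷ []) refl = [] , z≤n , trans (Φ₁ (a + 0)) (cong (_∷ []) (+-identityʳ a))
Φ-surjective {suc e} _ x refl with rotate-normalForm x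
... | s , z , rotations≡x with Φ-surjective (nX z) z refl
...   | m , m≤z , Φ≡z = (nX z ∸ Vec.sum m) ∷ m , S≤x , Φ≡x
  where
  S≡z : nX z ∸ Vec.sum m + Vec.sum m ≡ nX z
  S≡z = m∸n+n≡m m≤z
  x≡s+z : nX x ≡ s + nX z
  x≡s+z = trans (cong nX (sym rotations≡x)) (iter-rotate-sum s (0 ∷ z))
  S≤x : nX z ∸ Vec.sum m + Vec.sum m ≤ nX x
  S≤x = subst₂ _≤_ (sym S≡z) (sym x≡s+z) (m≤n+m (nX z) s)
  Φ≡x : Φ (nX x) ((nX z ∸ Vec.sum m) ∷ m) ≡ x
  Φ≡x = begin
    Φ (nX x) ((nX z ∸ Vec.sum m) ∷ m)   ≡⟨ Φ-step (nX x) (nX z ∸ Vec.sum m) m ⟩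
    iter (nX x ∸ S) rotate (0 ∷ Φ S m)  ≡⟨ cong₂ (λ k y → iter k rotate (0 ∷ y))
                                             (trans (cong₂ _∸_ x≡s+z S≡z) (m+n∸n≡m s (nX z)))
                                             (trans (cong (λ k → Φ k m) S≡z) Φ≡z) ⟩
    iter s rotate (0 ∷ z)               ≡⟨ rotations≡x ⟩
    x                                   ∎
    where
    open ≡-Reasoning
    S : ℕ
    S = nX z ∸ Vec.sum m + Vec.sum m

corollary1p5 : (d : ℕ) .{{_ : NonZero d}} (n W : ℕ) →
    ((m : Vec ℕ (d ∸ 1)) → IsPartition n W m → (nX (Φ n m) ≡ n) × (Wt (Φ n m) ≡ W))
    × ((m m′ : Vec ℕ (d ∸ 1)) → IsPartition n W m → IsPartition n W m′ → Φ n m ≡ Φ n m′ → m ≡ m′)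
    × ((x : Vec ℕ d) → nX x ≡ n → Wt x ≡ W → Σ (Vec ℕ (d ∸ 1)) (λ m → IsPartition n W m × (Φ n m ≡ x)))
corollary1p5 (suc e) n W =
    (λ m (weight , m≤n) → nX-Φ n m m≤n , trans (Wt-Φ n m m≤n) weight)
  , (λ m m′ (_ , m≤n) (_ , m′≤n) → Φ-injective n m m′ m≤n m′≤n)
  , λ x x↦n x↦W →
      let m , m≤n , Φ≡x = Φ-surjective n x x↦n
      in m , (trans (sym (Wt-Φ n m m≤n)) (trans (cong Wt Φ≡x) x↦W) , m≤n) , Φ≡x
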